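{- Let $c\ge 1$ and let $I=(G,X,k)$ be an instance of a-$c$-tdmod-IS with $G=(V,E,\mathcal{H})$, $R=V\setminus X$. Let $R'$ be the vertex set of a connected component of $G[R]$. If there exists an independent set $X' \subseteq X$ (i.e. no $H\in\mathcal{H}$ satisfies $H\subseteq X'$) such that ${\sf conf}_{R'}(X') > 0$, then there exists $\bar{X'} \in \mathcal{X}$ such that ${\sf conf}_{R'}(\bar{X'}) > 0$.
   Context: Treedepth ${\sf td}$: minimum height of a rooted forest whose closure (each vertex joined to all ancestors) contains the graph. An instance of a-$c$-tdmod-IS is $(G,X,k)$ where $G=(V,E,\mathcal{H})$ with $V=X\uplus R$, $E$ a set of 2-element edges each with one endpoint in $X$ and one in $R$ or both in $R$, $\mathcal{H}$ a set of hyperedges each contained in $X$, ${\sf td}(G[R])\le c$, and $k$ a positive integer; the question is whether $G$ has an independent set (a set $S\subseteq V$ with $h\not\subseteq S$ for all $h\in E\cup\mathcal{H}$) of size at least $k$. For $R'\subseteq R$, $\alpha(R')$ is the independence number of the graph $G[R']$; for $X'\subseteq X$, $N_{R'}(X')=\{v\in R' : \exists x\in X', \{x,v\}\in E\}$ and ${\sf conf}_{R'}(X')=\alpha(R')-\alpha(R'\setminus N_{R'}(X'))$. The set of chunks is $\mathcal{X}=\{X'\subseteq X : 0<|X'|\le 2^c \text{ and no } H\in\mathcal{H} \text{ satisfies } H\subseteq X'\}$. -}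

module Defs where

open import Data.Nat using (ℕ; zero; suc; _≤_; _<_; _⊔_; _∸_; _^_)
open import Data.Bool using (Bool; true; false; _∧_; _∨_; not; if_then_else_)
open import Data.Fin using (Fin)
open import Data.Fin.Subset using (Subset; _∈_; _∉_; _⊆_; ∣_∣; ∁; _─_; inside; outside)
open import Data.Vec using (Vec; []; _∷_; lookup; tabulate)
open import Data.List using (List; []; _∷_; _++_; map; foldr; allFin)
open import Data.Bool.ListAction using (any; all)
open import Data.List.Membership.Propositional using () renaming (_∈_ to _∈ₗ_)
open import Data.Product using (_×_; Σ; ∃; _,_)
open import Data.Sum using (_⊎_)
open import Data.Maybe using (Maybe; just; nothing)
open import Relation.Nullary using (¬_)
open import Relation.Nullary.Decidable using (⌊_⌋)
open import Relation.Binary.PropositionalEquality using (_≡_; _≢_)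
import Data.Fin as F

-- A graph-with-hyperedges on vertex set Fin n:
--   E : List (Fin n × Fin n)  -- 2-element edges (unordered; a pair (u,v) denotes {u,v})
--   H : List (Subset n)       -- hyperedges

Adj : ∀ {n} → List (Fin n × Fin n) → Fin n → Fin n → Set
Adj E u v = ((u , v) ∈ₗ E) ⊎ ((v , u) ∈ₗ E)

adjᵇ : ∀ {n} → List (Fin n × Fin n) → Fin n → Fin n → Bool
adjᵇ E u v = any (λ { (a , b) → (⌊ a F.≟ u ⌋ ∧ ⌊ b F.≟ v ⌋) ∨ (⌊ a F.≟ v ⌋ ∧ ⌊ b F.≟ u ⌋) }) E

_∈ᵇ_ : ∀ {n} → Fin n → Subset n → Bool
v ∈ᵇ S = lookup S v

_⊆ᵇ_ : ∀ {n} → Subset n → Subset n → Bool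
[] ⊆ᵇ [] = true
(a ∷ S) ⊆ᵇ (b ∷ T) = (not a ∨ b) ∧ (S ⊆ᵇ T)

indepᵇ : ∀ {n} → List (Fin n × Fin n) → Subset n → Bool
indepᵇ E S = all (λ { (u , v) → not (u ∈ᵇ S ∧ v ∈ᵇ S) }) E

allSubsets : ∀ n → List (Subset n)
allSubsets zero = [] ∷ []
allSubsets (suc n) = map (inside ∷_) (allSubsets n) ++ map (outside ∷_) (allSubsets n)

-- α(R') : independence number of the graph G[R'] (only 2-element edges matter,
-- since R' ⊆ R and hyperedges lie inside X): the maximum of |T| over T ⊆ R'
-- independent in (V,E).
α : ∀ {n} → List (Fin n × Fin n) → Subset n → ℕ
α {n} E R' = foldr _⊔_ 0
  (map (λ T → if (T ⊆ᵇ R') ∧ indepᵇ E T then ∣ T ∣ else 0) (allSubsets n))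

Nbh : ∀ {n} → List (Fin n × Fin n) → Subset n → Subset n → Subset n
Nbh {n} E R' X' = tabulate (λ v → (v ∈ᵇ R') ∧ any (λ x → (x ∈ᵇ X') ∧ adjᵇ E x v) (allFin n))

-- conf_{R'}(X') = α(R') - α(R' \ N_{R'}(X'))   (always ≥ 0 since α is monotone)
conf : ∀ {n} → List (Fin n × Fin n) → Subset n → Subset n → ℕ
conf E R' X' = α E R' ∸ α E (R' ─ Nbh E R' X')

NoHyperIn : ∀ {n} → List (Subset n) → Subset n → Set
NoHyperIn H S = ∀ h → h ∈ₗ H → ¬ (h ⊆ S)

IndepInX : ∀ {n} → Subset n → List (Subset n) → Subset n → Set
IndepInX X H X' = X' ⊆ X × NoHyperIn H X'

-- X' ∈ 𝒳 (a chunk): X' ⊆ X, 0 < |X'| ≤ 2^c, no hyperedge inside X'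
Chunk : ∀ {n} → ℕ → Subset n → List (Subset n) → Subset n → Set
Chunk c X H X' = X' ⊆ X × 0 < ∣ X' ∣ × ∣ X' ∣ ≤ 2 ^ c × NoHyperIn H X'

-- Rooted forests given by a parent function: Anc p u v means u is an ancestor of v
-- (reflexively).
data Anc {n} (p : Fin n → Maybe (Fin n)) (u : Fin n) : Fin n → Set where
  self : Anc p u u
  up   : ∀ {v w} → p v ≡ just w → Anc p u w → Anc p u v

-- A rooted forest with vertex set S, of height ≤ c (height = number of vertices
-- on a longest root-to-leaf path), whose closure contains every edge of G[S].
record TdForest {n} (E : List (Fin n × Fin n)) (S : Subset n) (c : ℕ) : Set where
  field
    parent  : Fin n → Maybe (Fin n)
    depth   : Fin n → ℕ
    depth≥1 : ∀ v → v ∈ S → 1 ≤ depth v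
    depth≤c : ∀ v → v ∈ S → depth v ≤ c
    root    : ∀ v → v ∈ S → parent v ≡ nothing → depth v ≡ 1
    child   : ∀ v w → v ∈ S → parent v ≡ just w → w ∈ S × depth v ≡ suc (depth w)
    closure : ∀ u v → u ∈ S → v ∈ S → Adj E u v → Anc parent u v ⊎ Anc parent v u

TdAtMost : ∀ {n} → List (Fin n × Fin n) → Subset n → ℕ → Set
TdAtMost E S c = TdForest E S c

-- Instance of a-c-tdmod-IS: V = Fin n, X ⊆ V, R = ∁ X.
record IsInstance (c n : ℕ) (X : Subset n) (E : List (Fin n × Fin n))
                  (H : List (Subset n)) (k : ℕ) : Set where
  field
    edge-2elem : ∀ u v → (u , v) ∈ₗ E → u ≢ v
    edge-type  : ∀ u v → (u , v) ∈ₗ E →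
                 (u ∈ X × v ∈ ∁ X) ⊎ (u ∈ ∁ X × v ∈ X) ⊎ (u ∈ ∁ X × v ∈ ∁ X)
    hyper-in-X : ∀ h → h ∈ₗ H → h ⊆ X
    td-R       : TdAtMost E (∁ X) c
    k-pos      : 0 < k

data Path {n} (E : List (Fin n × Fin n)) (S : Subset n) : Fin n → Fin n → Set where
  here : ∀ {u} → u ∈ S → Path E S u u
  step : ∀ {u w v} → u ∈ S → Adj E u w → Path E S w v → Path E S u v

IsComponent : ∀ {n} → List (Fin n × Fin n) → Subset n → Subset n → Set
IsComponent E R R' =
  R' ⊆ R ×
  (∃ λ u → u ∈ R') ×
  (∀ u v → u ∈ R' → v ∈ R' → Path E R' u v) ×
  (∀ u v → u ∈ R' → v ∈ R → Adj E u v → v ∈ R')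

module Submission where

-- Write N(Z) = N_{R'}(Z) and α for the independence number.  The claim is that a
-- drop α(R' ─ N(X')) < α(R') is already witnessed by some Z ⊆ X' with |Z| ≤ 2^c.
-- We prove the stronger, inductive statement (`chunk` below): if S lies in the
-- d deepest levels of the treedepth forest of G[R], α(S) ≤ a and α(S ─ N(Z)) < a,
-- then some Z' ⊆ Z with |Z'| ≤ 2^d already gives α(S ─ N(Z')) < a.  Induction on d
-- and then on |S|: let r be a shallowest vertex of S and D its descendants in S.
-- No edge leaves D inside S, so α(S ─ M) = α((S ─ D) ─ M) + α(D ─ M) for every M.
-- If α drops on D we treat D alone: D - r lies in d levels, one chunk handles D - r,
-- and r is handled either by one neighbour of r in Z or by a chunk of D ─ N[r];
-- two chunks of size 2^d make one of size 2^(d+1).  Otherwise the whole drop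
-- happens on S ─ D, which is smaller.  Finally Z' is nonempty since N(∅) = ∅.

open import Defs
open import Data.Nat using (ℕ; _≤_; _<_)
open import Data.Fin using (Fin)
open import Data.Fin.Subset using (Subset; ∁)
open import Data.List using (List)
open import Data.Product using (_×_; Σ; ∃)

open import Data.Nat using (zero; suc; _+_; _∸_; _⊔_; _^_; z≤n; s≤s; _<?_; _≤?_)
open import Data.Nat.Properties
open import Data.Nat.Induction using (<-wellFounded)
open import Induction.WellFounded using (Acc; acc)
open import Data.Bool using (Bool; true; false; T; not; _∧_; _∨_; if_then_else_)
open import Data.Bool.Properties using (T-∧; T-∨; T-≡)
open import Data.Fin using (zero; suc) renaming (_≟_ to _≟ᶠ_)
open import Data.Fin.Properties using (any?)
open import Data.Fin.Subset
  using (_∈_; _∉_; _⊆_; _∪_; _∩_; _─_; _-_; ⁅_⁆; ∣_∣; Nonempty; Empty; inside; outside)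
  renaming (⊥ to ∅)
open import Data.Fin.Subset.Properties
  using ( ⊆-refl; ⊆-trans; ⊆-reflexive; drop-∷-⊆; ∉⊥; ∣⊥∣≡0; x∈⁅x⁆; x∈⁅y⁆⇒x≡y; ∣⁅x⁆∣≡1
        ; p⊆q⇒∣p∣≤∣q∣; x∈p∩q⁺; x∈p∩q⁻; x∈p∪q⁺; x∈p∪q⁻; x∈p∧x∉q⇒x∈p─q; p─q⊆p
        ; p─⊥≡p; p─q─r≡p─r─q; x∈p∧x≢y⇒x∈p-y; x∈p⇒∣p-x∣<∣p∣; p∩q≢∅⇒∣p─q∣<∣p∣
        ; nonempty?; _∈?_; p⊆p∪q; q⊆p∪q)
open import Data.Vec using ([]; _∷_; here; there; lookup; tabulate)
open import Data.Vec.Properties using (lookup∘tabulate)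
open import Data.List using (map; foldr; allFin)
open import Data.List.Membership.Propositional using (lose) renaming (_∈_ to _∈ₗ_)
open import Data.List.Membership.Propositional.Properties using (∈-allFin; ∈-map⁺; ∈-++⁺ˡ; ∈-++⁺ʳ)
import Data.List.Membership.DecPropositional as DecMembership
open import Data.List.Relation.Unary.Any as Any using (satisfied)
open import Data.List.Relation.Unary.Any.Properties using (any⁺; any⁻)
import Data.List.Relation.Unary.All as All
open import Data.List.Relation.Unary.All.Properties using (all⁺; all⁻) renaming (map⁺ to All-map⁺)
open import Data.List.Properties using (foldr-preservesᵇ)
open import Data.Product using (_,_; proj₁; proj₂)
open import Data.Product.Properties using (≡-dec)
open import Data.Sum using (_⊎_; inj₁; inj₂)
open import Data.Empty using (⊥; ⊥-elim)
open import Data.Maybe using (just; maybe)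
open import Function using (Equivalence; _∘_)
open import Relation.Nullary using (¬_; yes; no; Dec; contradiction)
open import Relation.Nullary.Decidable using (⌊_⌋; toWitness; fromWitness; _⊎-dec_; _×-dec_)
open import Relation.Binary.PropositionalEquality using (_≡_; _≢_; refl; sym; trans; cong; subst; subst₂)

open Equivalence using (to; from)


∈⇒T : ∀ {n} {p : Subset n} {x} → x ∈ p → T (lookup p x)
∈⇒T here        = _
∈⇒T (there x∈p) = ∈⇒T x∈p

T⇒∈ : ∀ {n} {p : Subset n} {x} → T (lookup p x) → x ∈ p
T⇒∈ {p = inside ∷ p}  {zero}  _ = here
T⇒∈ {p = outside ∷ p} {zero}  ()
T⇒∈ {p = _ ∷ p}       {suc x} t = there (T⇒∈ t)

∈-tabulate⁺ : ∀ {n} {f : Fin n → Bool} {x} → T (f x) → x ∈ tabulate f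
∈-tabulate⁺ {f = f} {x} t = T⇒∈ (subst T (sym (lookup∘tabulate f x)) t)

∈-tabulate⁻ : ∀ {n} {f : Fin n → Bool} {x} → x ∈ tabulate f → T (f x)
∈-tabulate⁻ {f = f} {x} x∈ = subst T (lookup∘tabulate f x) (∈⇒T x∈)

x∈p─q⇒x∉q : ∀ {n} (p q : Subset n) {x} → x ∈ p ─ q → x ∉ q
x∈p─q⇒x∉q (_ ∷ p) (outside ∷ q) (there x∈) (there x∈q) = x∈p─q⇒x∉q p q x∈ x∈q
x∈p─q⇒x∉q (_ ∷ p) (inside ∷ q)  (there x∈) (there x∈q) = x∈p─q⇒x∉q p q x∈ x∈q

─-mono : ∀ {n} {p p' q q' : Subset n} → p ⊆ p' → q' ⊆ q → p ─ q ⊆ p' ─ q'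
─-mono {p = p} {q = q} p⊆p' q'⊆q x∈ =
  x∈p∧x∉q⇒x∈p─q (p⊆p' (p─q⊆p p q x∈)) (λ x∈q' → x∈p─q⇒x∉q p q x∈ (q'⊆q x∈q'))

∪-⊆ : ∀ {n} {p q r : Subset n} → p ⊆ r → q ⊆ r → p ∪ q ⊆ r
∪-⊆ {p = p} {q} p⊆r q⊆r x∈ with x∈p∪q⁻ p q x∈
... | inj₁ x∈p = p⊆r x∈p
... | inj₂ x∈q = q⊆r x∈q

∣p∣>0 : ∀ {n} {p : Subset n} {x} → x ∈ p → 0 < ∣ p ∣
∣p∣>0 x∈p = ≤-<-trans z≤n (x∈p⇒∣p-x∣<∣p∣ x∈p)

∣p∪q∣≤∣p∣+∣q∣ : ∀ {n} (p q : Subset n) → ∣ p ∪ q ∣ ≤ ∣ p ∣ + ∣ q ∣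
∣p∪q∣≤∣p∣+∣q∣ []            []            = z≤n
∣p∪q∣≤∣p∣+∣q∣ (outside ∷ p) (outside ∷ q) = ∣p∪q∣≤∣p∣+∣q∣ p q
∣p∪q∣≤∣p∣+∣q∣ (outside ∷ p) (inside ∷ q)  =
  ≤-trans (s≤s (∣p∪q∣≤∣p∣+∣q∣ p q)) (≤-reflexive (sym (+-suc ∣ p ∣ ∣ q ∣)))
∣p∪q∣≤∣p∣+∣q∣ (inside ∷ p)  (outside ∷ q) = s≤s (∣p∪q∣≤∣p∣+∣q∣ p q)
∣p∪q∣≤∣p∣+∣q∣ (inside ∷ p)  (inside ∷ q)  =
  s≤s (≤-trans (∣p∪q∣≤∣p∣+∣q∣ p q) (+-monoʳ-≤ ∣ p ∣ (n≤1+n ∣ q ∣)))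

∣p∣+∣q∣≤∣p∪q∣ : ∀ {n} (p q : Subset n) → (∀ {x} → x ∈ p → x ∉ q) → ∣ p ∣ + ∣ q ∣ ≤ ∣ p ∪ q ∣
∣p∣+∣q∣≤∣p∪q∣ []            []            _        = z≤n
∣p∣+∣q∣≤∣p∪q∣ (inside ∷ p)  (inside ∷ q)  disjoint = ⊥-elim (disjoint here here)
∣p∣+∣q∣≤∣p∪q∣ (inside ∷ p)  (outside ∷ q) disjoint =
  s≤s (∣p∣+∣q∣≤∣p∪q∣ p q (λ x∈p x∈q → disjoint (there x∈p) (there x∈q)))
∣p∣+∣q∣≤∣p∪q∣ (outside ∷ p) (inside ∷ q)  disjoint =
  ≤-trans (≤-reflexive (+-suc ∣ p ∣ ∣ q ∣))
          (s≤s (∣p∣+∣q∣≤∣p∪q∣ p q (λ x∈p x∈q → disjoint (there x∈p) (there x∈q))))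
∣p∣+∣q∣≤∣p∪q∣ (outside ∷ p) (outside ∷ q) disjoint =
  ∣p∣+∣q∣≤∣p∪q∣ p q (λ x∈p x∈q → disjoint (there x∈p) (there x∈q))

∣p∪q∣≤2^suc : ∀ {n} d {p q : Subset n} → ∣ p ∣ ≤ 2 ^ d → ∣ q ∣ ≤ 2 ^ d → ∣ p ∪ q ∣ ≤ 2 ^ suc d
∣p∪q∣≤2^suc d {p} {q} ∣p∣≤ ∣q∣≤ =
  ≤-trans (∣p∪q∣≤∣p∣+∣q∣ p q)
          (≤-trans (+-mono-≤ ∣p∣≤ ∣q∣≤) (≤-reflexive (cong (2 ^ d +_) (sym (+-identityʳ (2 ^ d))))))

minimiser : ∀ {n} (f : Fin n → ℕ) (S : Subset n) → Nonempty S →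
            ∃ λ r → r ∈ S × (∀ {w} → w ∈ S → f r ≤ f w)
minimiser f S (v , v∈S) = descend v v∈S (<-wellFounded (f v))
  where
  descend : ∀ v → v ∈ S → Acc _<_ (f v) → ∃ λ r → r ∈ S × (∀ {w} → w ∈ S → f r ≤ f w)
  descend v v∈S (acc smaller) with any? (λ w → w ∈? S ×-dec f w <? f v)
  ... | yes (w , w∈S , fw<fv) = descend w w∈S (smaller fw<fv)
  ... | no none = v , v∈S , λ {w} w∈S → ≮⇒≥ (λ fw<fv → none (w , w∈S , fw<fv))

⊆ᵇ-sound : ∀ {n} (p q : Subset n) → T (p ⊆ᵇ q) → p ⊆ q
⊆ᵇ-sound (inside ∷ p)  (inside ∷ q)  _ here       = here
⊆ᵇ-sound (inside ∷ p)  (outside ∷ q) () here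
⊆ᵇ-sound (s ∷ p)       (t ∷ q)       b (there x∈) =
  there (⊆ᵇ-sound p q (proj₂ (to (T-∧ {not s ∨ t}) b)) x∈)

⊆ᵇ-complete : ∀ {n} (p q : Subset n) → p ⊆ q → T (p ⊆ᵇ q)
⊆ᵇ-complete []            []      _   = _
⊆ᵇ-complete (outside ∷ p) (_ ∷ q) sub = ⊆ᵇ-complete p q (drop-∷-⊆ sub)
⊆ᵇ-complete (inside ∷ p)  (_ ∷ q) sub with sub here
... | here = ⊆ᵇ-complete p q (drop-∷-⊆ sub)

∈-allSubsets : ∀ {n} (p : Subset n) → p ∈ₗ allSubsets n
∈-allSubsets []                  = Any.here refl
∈-allSubsets {suc n} (inside ∷ p)  = ∈-++⁺ˡ (∈-map⁺ (inside ∷_) (∈-allSubsets p))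
∈-allSubsets {suc n} (outside ∷ p) =
  ∈-++⁺ʳ (map (inside ∷_) (allSubsets n)) (∈-map⁺ (outside ∷_) (∈-allSubsets p))

≤-foldr-⊔ : ∀ {A : Set} (f : A → ℕ) {xs x} → x ∈ₗ xs → f x ≤ foldr _⊔_ 0 (map f xs)
≤-foldr-⊔ f (Any.here refl)  = m≤m⊔n _ _
≤-foldr-⊔ f (Any.there x∈xs) = m≤n⇒m≤o⊔n _ (≤-foldr-⊔ f x∈xs)

-- The independence number: α E Y is attained by an independent subset of Y and
-- bounds all of them; everything else about α follows from these two facts.

module IndependenceNumber {n : ℕ} (E : List (Fin n × Fin n)) where

  Independent : Subset n → Set
  Independent I = ∀ {u v} → (u , v) ∈ₗ E → u ∈ I → v ∈ I → ⊥

  independent-⊆ : ∀ {I J} → J ⊆ I → Independent I → Independent J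
  independent-⊆ J⊆I ind e u∈ v∈ = ind e (J⊆I u∈) (J⊆I v∈)

  indepᵇ-sound : ∀ I → T (indepᵇ E I) → Independent I
  indepᵇ-sound I t {u} {v} e u∈ v∈ = notBoth (All.lookup (all⁺ _ E t) e) (∈⇒T u∈) (∈⇒T v∈)
    where
    notBoth : ∀ {a b} → T (not (a ∧ b)) → T a → T b → ⊥
    notBoth {true} {true} ()

  indepᵇ-complete : ∀ I → Independent I → T (indepᵇ E I)
  indepᵇ-complete I ind =
    all⁻ _ {E} (All.tabulate λ { {u , v} e → notBoth (λ tu tv → ind e (T⇒∈ tu) (T⇒∈ tv)) })
    where
    notBoth : ∀ {a b} → (T a → T b → ⊥) → T (not (a ∧ b))
    notBoth {true}  {true}  both = both _ _
    notBoth {true}  {false} _    = _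
    notBoth {false}         _    = _

  candidate : Subset n → Subset n → ℕ
  candidate Y I = if (I ⊆ᵇ Y) ∧ indepᵇ E I then ∣ I ∣ else 0

  α-upper : ∀ {Y I} → I ⊆ Y → Independent I → ∣ I ∣ ≤ α E Y
  α-upper {Y} {I} I⊆Y ind = subst (_≤ α E Y) recorded (≤-foldr-⊔ (candidate Y) (∈-allSubsets I))
    where
    recorded : candidate Y I ≡ ∣ I ∣
    recorded rewrite to T-≡ (⊆ᵇ-complete I Y I⊆Y) | to T-≡ (indepᵇ-complete I ind) = refl

  Attained : Subset n → ℕ → Set
  Attained Y m = ∃ λ I → I ⊆ Y × Independent I × ∣ I ∣ ≡ m

  α-witness : ∀ Y → Attained Y (α E Y)
  α-witness Y = foldr-preservesᵇ {P = Attained Y} larger empty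
                  (All-map⁺ (All.universal recordedAttained (allSubsets n)))
    where
    empty : Attained Y 0
    empty = ∅ , (λ x∈∅ → ⊥-elim (∉⊥ x∈∅)) , (λ _ u∈∅ _ → ∉⊥ u∈∅) , ∣⊥∣≡0 n
    larger : ∀ {x y} → Attained Y x → Attained Y y → Attained Y (x ⊔ y)
    larger {x} {y} ax ay with ⊔-sel x y
    ... | inj₁ eq = subst (Attained Y) (sym eq) ax
    ... | inj₂ eq = subst (Attained Y) (sym eq) ay
    recordedAttained : ∀ I → Attained Y (candidate Y I)
    recordedAttained I with (I ⊆ᵇ Y) ∧ indepᵇ E I in eq
    ... | true  = let tests = to (T-∧ {I ⊆ᵇ Y}) (from T-≡ eq)
                  in I , ⊆ᵇ-sound I Y (proj₁ tests) , indepᵇ-sound I (proj₂ tests) , refl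
    ... | false = empty

  α-mono : ∀ {Y Z} → Y ⊆ Z → α E Y ≤ α E Z
  α-mono {Y} {Z} Y⊆Z with α-witness Y
  ... | I , I⊆Y , ind , ∣I∣≡α = subst (_≤ α E Z) ∣I∣≡α (α-upper (⊆-trans I⊆Y Y⊆Z) ind)

  α-subadditive : ∀ {Y P Q} → Y ⊆ P ∪ Q → α E Y ≤ α E P + α E Q
  α-subadditive {Y} {P} {Q} cover with α-witness Y
  ... | I , I⊆Y , ind , ∣I∣≡α = subst (_≤ α E P + α E Q) ∣I∣≡α (begin
    ∣ I ∣                  ≤⟨ p⊆q⇒∣p∣≤∣q∣ splitI ⟩
    ∣ (I ∩ P) ∪ (I ∩ Q) ∣  ≤⟨ ∣p∪q∣≤∣p∣+∣q∣ (I ∩ P) (I ∩ Q) ⟩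
    ∣ I ∩ P ∣ + ∣ I ∩ Q ∣  ≤⟨ +-mono-≤ (part P) (part Q) ⟩
    α E P + α E Q          ∎)
    where
    open ≤-Reasoning
    part : ∀ R → ∣ I ∩ R ∣ ≤ α E R
    part R = α-upper (λ x∈ → proj₂ (x∈p∩q⁻ I R x∈))
                     (independent-⊆ (λ x∈ → proj₁ (x∈p∩q⁻ I R x∈)) ind)
    splitI : I ⊆ (I ∩ P) ∪ (I ∩ Q)
    splitI x∈I with x∈p∪q⁻ P Q (cover (I⊆Y x∈I))
    ... | inj₁ x∈P = x∈p∪q⁺ (inj₁ (x∈p∩q⁺ (x∈I , x∈P)))
    ... | inj₂ x∈Q = x∈p∪q⁺ (inj₂ (x∈p∩q⁺ (x∈I , x∈Q)))

  Separated : Subset n → Subset n → Set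
  Separated P Q = (∀ {v} → v ∈ P → v ∉ Q) × (∀ {u v} → u ∈ P → v ∈ Q → Adj E u v → ⊥)

  separated-⊆ : ∀ {P P' Q Q'} → P' ⊆ P → Q' ⊆ Q → Separated P Q → Separated P' Q'
  separated-⊆ P'⊆P Q'⊆Q (disjoint , noEdge) =
    (λ v∈P' v∈Q' → disjoint (P'⊆P v∈P') (Q'⊆Q v∈Q')) ,
    (λ u∈P' v∈Q' → noEdge (P'⊆P u∈P') (Q'⊆Q v∈Q'))

  -- Independent sets of two separated parts of Y combine to one of Y.
  α-superadditive : ∀ {Y P Q} → P ⊆ Y → Q ⊆ Y → Separated P Q → α E P + α E Q ≤ α E Y
  α-superadditive {Y} {P} {Q} P⊆Y Q⊆Y (disjoint , noEdge)
    with α-witness P | α-witness Q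
  ... | I , I⊆P , indI , ∣I∣≡αP | J , J⊆Q , indJ , ∣J∣≡αQ =
    subst₂ (λ x y → x + y ≤ α E Y) ∣I∣≡αP ∣J∣≡αQ
      (≤-trans (∣p∣+∣q∣≤∣p∪q∣ I J (λ x∈I x∈J → disjoint (I⊆P x∈I) (J⊆Q x∈J)))
               (α-upper (∪-⊆ (⊆-trans I⊆P P⊆Y) (⊆-trans J⊆Q Q⊆Y)) indIJ))
    where
    indIJ : Independent (I ∪ J)
    indIJ e u∈ v∈ with x∈p∪q⁻ I J u∈ | x∈p∪q⁻ I J v∈
    ... | inj₁ u∈I | inj₁ v∈I = indI e u∈I v∈I
    ... | inj₂ u∈J | inj₂ v∈J = indJ e u∈J v∈J
    ... | inj₁ u∈I | inj₂ v∈J = noEdge (I⊆P u∈I) (J⊆Q v∈J) (inj₁ e)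
    ... | inj₂ u∈J | inj₁ v∈I = noEdge (I⊆P v∈I) (J⊆Q u∈J) (inj₂ e)

  α-additive : ∀ {Y P Q} → Y ⊆ P ∪ Q → P ⊆ Y → Q ⊆ Y → Separated P Q → α E Y ≡ α E P + α E Q
  α-additive cover P⊆Y Q⊆Y sep = ≤-antisym (α-subadditive cover) (α-superadditive P⊆Y Q⊆Y sep)

  α-split-─ : ∀ {S D} → D ⊆ S → Separated (S ─ D) D →
              ∀ M → α E (S ─ M) ≡ α E ((S ─ D) ─ M) + α E (D ─ M)
  α-split-─ {S} {D} D⊆S sep M =
    α-additive cover (─-mono (p─q⊆p S D) ⊆-refl) (─-mono D⊆S ⊆-refl)
                     (separated-⊆ (p─q⊆p (S ─ D) M) (p─q⊆p D M) sep)
    where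
    cover : S ─ M ⊆ ((S ─ D) ─ M) ∪ (D ─ M)
    cover {v} v∈ with v ∈? D
    ... | yes v∈D = x∈p∪q⁺ (inj₂ (x∈p∧x∉q⇒x∈p─q v∈D (x∈p─q⇒x∉q S M v∈)))
    ... | no  v∉D = x∈p∪q⁺ (inj₁ (x∈p∧x∉q⇒x∈p─q (x∈p∧x∉q⇒x∈p─q (p─q⊆p S M v∈) v∉D)
                                                  (x∈p─q⇒x∉q S M v∈)))

  α-split : ∀ {S D} → D ⊆ S → Separated (S ─ D) D → α E S ≡ α E (S ─ D) + α E D
  α-split {S} {D} D⊆S sep
    with α-split-─ D⊆S sep ∅
  ... | splitting rewrite p─⊥≡p S | p─⊥≡p (S ─ D) | p─⊥≡p D = splitting

  adjacent? : ∀ u v → Dec (Adj E u v)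
  adjacent? u v = (u , v) ∈?ₗ E ⊎-dec (v , u) ∈?ₗ E
    where open DecMembership (≡-dec _≟ᶠ_ _≟ᶠ_) renaming (_∈?_ to _∈?ₗ_)

  closedNbh : Fin n → Subset n
  closedNbh r = ⁅ r ⁆ ∪ tabulate (λ v → ⌊ adjacent? r v ⌋)

  r∈N[r] : ∀ r → r ∈ closedNbh r
  r∈N[r] r = x∈p∪q⁺ (inj₁ (x∈⁅x⁆ r))

  adj⇒∈N[r] : ∀ {r v} → Adj E r v → v ∈ closedNbh r
  adj⇒∈N[r] r~v = x∈p∪q⁺ (inj₂ (∈-tabulate⁺ (fromWitness r~v)))

  ∈N[r]⁻ : ∀ {r v} → v ∈ closedNbh r → v ≡ r ⊎ Adj E r v
  ∈N[r]⁻ {r} {v} v∈ with x∈p∪q⁻ ⁅ r ⁆ _ v∈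
  ... | inj₁ v∈⁅r⁆ = inj₁ (x∈⁅y⁆⇒x≡y r v∈⁅r⁆)
  ... | inj₂ v∈adj = inj₂ (toWitness (∈-tabulate⁻ v∈adj))

  ─N[r]⊆-r : ∀ Y r → Y ─ closedNbh r ⊆ Y - r
  ─N[r]⊆-r Y r = ─-mono ⊆-refl (λ v∈⁅r⁆ → subst (_∈ closedNbh r) (sym (x∈⁅y⁆⇒x≡y r v∈⁅r⁆)) (r∈N[r] r))

  -- In a loopless graph, r extends every independent set of Y ─ N[r] (for r ∈ Y).
  α-closedNbh-lower : (∀ u v → (u , v) ∈ₗ E → u ≢ v) →
                      ∀ {Y r} → r ∈ Y → suc (α E (Y ─ closedNbh r)) ≤ α E Y
  α-closedNbh-lower loopless {Y} {r} r∈Y =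
    ≤-trans (+-monoˡ-≤ (α E (Y ─ closedNbh r)) α⁅r⁆≥1)
            (α-superadditive ⁅r⁆⊆Y (p─q⊆p Y (closedNbh r)) (disjoint , noEdge))
    where
    ⁅r⁆⊆Y : ⁅ r ⁆ ⊆ Y
    ⁅r⁆⊆Y v∈ rewrite x∈⁅y⁆⇒x≡y r v∈ = r∈Y
    α⁅r⁆≥1 : 1 ≤ α E ⁅ r ⁆
    α⁅r⁆≥1 = subst (_≤ α E ⁅ r ⁆) (∣⁅x⁆∣≡1 r) (α-upper ⊆-refl λ e u∈ v∈ →
               loopless _ _ e (trans (x∈⁅y⁆⇒x≡y r u∈) (sym (x∈⁅y⁆⇒x≡y r v∈))))
    disjoint : ∀ {v} → v ∈ ⁅ r ⁆ → v ∉ Y ─ closedNbh r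
    disjoint v∈ v∈Y─N rewrite x∈⁅y⁆⇒x≡y r v∈ = x∈p─q⇒x∉q Y (closedNbh r) v∈Y─N (r∈N[r] r)
    noEdge : ∀ {u v} → u ∈ ⁅ r ⁆ → v ∈ Y ─ closedNbh r → Adj E u v → ⊥
    noEdge u∈ v∈ u~v rewrite x∈⁅y⁆⇒x≡y r u∈ = x∈p─q⇒x∉q Y (closedNbh r) v∈ (adj⇒∈N[r] u~v)

  -- An independent set of Y either avoids r, or is r together with an independent
  -- set of Y ─ N[r].
  α-closedNbh-upper : ∀ Y r → α E Y ≤ α E (Y - r) ⊔ suc (α E (Y ─ closedNbh r))
  α-closedNbh-upper Y r with α-witness Y
  ... | I , I⊆Y , ind , ∣I∣≡α with r ∈? I
  ...   | no r∉I =
    subst (_≤ α E (Y - r) ⊔ suc (α E (Y ─ closedNbh r))) ∣I∣≡α (m≤n⇒m≤n⊔o _ (α-upper avoid ind))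
    where
    avoid : I ⊆ Y - r
    avoid x∈I = x∈p∧x≢y⇒x∈p-y (I⊆Y x∈I) (λ { refl → r∉I x∈I })
  ...   | yes r∈I = subst (_≤ α E (Y - r) ⊔ suc (α E (Y ─ closedNbh r))) ∣I∣≡α (m≤n⇒m≤o⊔n _ (begin
    ∣ I ∣                  ≤⟨ p⊆q⇒∣p∣≤∣q∣ splitI ⟩
    ∣ ⁅ r ⁆ ∪ (I - r) ∣    ≤⟨ ∣p∪q∣≤∣p∣+∣q∣ ⁅ r ⁆ (I - r) ⟩
    ∣ ⁅ r ⁆ ∣ + ∣ I - r ∣  ≡⟨ cong (_+ ∣ I - r ∣) (∣⁅x⁆∣≡1 r) ⟩
    suc ∣ I - r ∣          ≤⟨ s≤s (α-upper rest (independent-⊆ (p─q⊆p I ⁅ r ⁆) ind)) ⟩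
    suc (α E (Y ─ closedNbh r)) ∎))
    where
    open ≤-Reasoning
    splitI : I ⊆ ⁅ r ⁆ ∪ (I - r)
    splitI {x} x∈I with x ≟ᶠ r
    ... | yes refl = x∈p∪q⁺ (inj₁ (x∈⁅x⁆ r))
    ... | no  x≢r  = x∈p∪q⁺ (inj₂ (x∈p∧x≢y⇒x∈p-y x∈I x≢r))
    rest : I - r ⊆ Y ─ closedNbh r
    rest x∈ = x∈p∧x∉q⇒x∈p─q (I⊆Y x∈I) notNbh
      where
      x∈I = p─q⊆p I ⁅ r ⁆ x∈
      notNbh : _ ∉ closedNbh r
      notNbh x∈N with ∈N[r]⁻ x∈N
      ... | inj₁ refl        = x∈p─q⇒x∉q I ⁅ r ⁆ x∈ (x∈⁅x⁆ r)
      ... | inj₂ (inj₁ edge) = ind edge r∈I x∈I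
      ... | inj₂ (inj₂ edge) = ind edge x∈I r∈I

-- Ancestors and descendants in a treedepth forest.

module Levels {n c : ℕ} {E : List (Fin n × Fin n)} {F : Subset n} (forest : TdForest E F c) where

  open TdForest forest
  open IndependenceNumber E using (Separated)

  anc-depth : ∀ {u v} → Anc parent u v → v ∈ F → u ≡ v ⊎ depth u < depth v
  anc-depth self _ = inj₁ refl
  anc-depth {v = v} (up {w = w} v→w u-w) v∈F with child v w v∈F v→w
  ... | w∈F , depth-v with anc-depth u-w w∈F
  ...   | inj₁ refl = inj₂ (≤-reflexive (sym depth-v))
  ...   | inj₂ lt   = inj₂ (<-trans lt (≤-reflexive (sym depth-v)))

  anc-trans : ∀ {a b d} → Anc parent a b → Anc parent b d → Anc parent a d
  anc-trans a-b self        = a-b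
  anc-trans a-b (up d→w b-w) = up d→w (anc-trans a-b b-w)

  -- Two ancestors of the same vertex are comparable, since parents are unique.
  anc-comparable : ∀ {a b u} → Anc parent a u → Anc parent b u → Anc parent a b ⊎ Anc parent b a
  anc-comparable self         b-u          = inj₂ b-u
  anc-comparable (up u→w a-w) self         = inj₁ (up u→w a-w)
  anc-comparable (up u→w a-w) (up u→w' b-w') with trans (sym u→w) u→w'
  ... | refl = anc-comparable a-w b-w'

  -- Is u among the first m + 1 vertices on the path from v to its root?
  ancestorWithin : ℕ → Fin n → Fin n → Bool
  ancestorWithin zero    u v = ⌊ u ≟ᶠ v ⌋
  ancestorWithin (suc m) u v = ⌊ u ≟ᶠ v ⌋ ∨ maybe (ancestorWithin m u) false (parent v)

  ancestorWithin-sound : ∀ m {u v} → T (ancestorWithin m u v) → Anc parent u v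
  ancestorWithin-sound zero    t rewrite toWitness t = self
  ancestorWithin-sound (suc m) {u} {v} t with to (T-∨ {⌊ u ≟ᶠ v ⌋}) t
  ... | inj₁ u≡v rewrite toWitness u≡v = self
  ... | inj₂ above with parent v in v→
  ...   | just w = up v→ (ancestorWithin-sound m above)

  ancestorWithin-complete : ∀ m {u v} → Anc parent u v → v ∈ F → depth v ≤ suc m →
                            T (ancestorWithin m u v)
  ancestorWithin-complete zero    self _ _ = fromWitness refl
  ancestorWithin-complete (suc m) {u} self _ _ = from (T-∨ {⌊ u ≟ᶠ u ⌋}) (inj₁ (fromWitness refl))
  ancestorWithin-complete zero    {v = v} (up {w = w} v→w _) v∈F shallow
    with child v w v∈F v→w
  ... | w∈F , depth-v = ⊥-elim (<⇒≱ (s≤s (depth≥1 w w∈F)) (subst (_≤ 1) depth-v shallow))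
  ancestorWithin-complete (suc m) {u} {v} (up {w = w} v→w u-w) v∈F shallow
    with child v w v∈F v→w
  ... | w∈F , depth-v rewrite v→w =
    from (T-∨ {⌊ u ≟ᶠ v ⌋}) (inj₂ (ancestorWithin-complete m u-w w∈F
                                    (≤-pred (subst (_≤ suc (suc m)) depth-v shallow))))

  -- The descendants of r inside S; depths are at most c, so c steps up suffice.
  desc : Subset n → Fin n → Subset n
  desc S r = S ∩ tabulate (ancestorWithin c r)

  ∈desc⁻ : ∀ {S r v} → v ∈ desc S r → v ∈ S × Anc parent r v
  ∈desc⁻ {S} v∈ with x∈p∩q⁻ S _ v∈
  ... | v∈S , below = v∈S , ancestorWithin-sound c (∈-tabulate⁻ below)

  ∈desc⁺ : ∀ {S r v} → v ∈ F → v ∈ S → Anc parent r v → v ∈ desc S r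
  ∈desc⁺ {v = v} v∈F v∈S r-v =
    x∈p∩q⁺ (v∈S , ∈-tabulate⁺ (ancestorWithin-complete c r-v v∈F (m≤n⇒m≤1+n (depth≤c v v∈F))))

  -- S lies in the d deepest levels c - d + 1, …, c of the forest, so the forest
  -- induced on S has height at most d.
  WithinLevels : ℕ → Subset n → Set
  WithinLevels d S = ∀ {v} → v ∈ S → v ∈ F × c < depth v + d

  within-⊆ : ∀ {d S S'} → S' ⊆ S → WithinLevels d S → WithinLevels d S'
  within-⊆ S'⊆S within v∈S' = within (S'⊆S v∈S')

  within-zero : ∀ {S} → WithinLevels 0 S → Empty S
  within-zero within (v , v∈S) with within v∈S
  ... | v∈F , deep = <⇒≱ (subst (c <_) (+-identityʳ (depth v)) deep) (depth≤c v v∈F)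

  module Subtree {d S r} (within : WithinLevels (suc d) S) (r∈S : r ∈ S)
                 (shallowest : ∀ {w} → w ∈ S → depth r ≤ depth w) where

    D : Subset n
    D = desc S r

    D⊆S : D ⊆ S
    D⊆S v∈D = proj₁ (∈desc⁻ v∈D)

    r∈D : r ∈ D
    r∈D = ∈desc⁺ (proj₁ (within r∈S)) r∈S self

    within-below-root : WithinLevels d (D - r)
    within-below-root {v} v∈ with ∈desc⁻ (p─q⊆p D ⁅ r ⁆ v∈)
    ... | v∈S , r-v with within v∈S | anc-depth r-v (proj₁ (within v∈S))
    ...   | _ , _ | inj₁ refl = ⊥-elim (x∈p─q⇒x∉q D ⁅ r ⁆ v∈ (x∈⁅x⁆ r))
    ...   | v∈F , _ | inj₂ r<v = v∈F , (begin-strict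
      c                 <⟨ proj₂ (within r∈S) ⟩
      depth r + suc d   ≡⟨ +-suc (depth r) d ⟩
      suc (depth r) + d ≤⟨ +-monoˡ-≤ d r<v ⟩
      depth v + d       ∎)
      where open ≤-Reasoning

    separated : Separated (S ─ D) D
    separated = (λ v∈ v∈D → x∈p─q⇒x∉q S D v∈ v∈D) , noEdge
      where
      outside-subtree : ∀ {u} → u ∈ S ─ D → ¬ Anc parent r u
      outside-subtree {u} u∈ r-u =
        x∈p─q⇒x∉q S D u∈ (∈desc⁺ (proj₁ (within (p─q⊆p S D u∈))) (p─q⊆p S D u∈) r-u)
      noEdge : ∀ {u v} → u ∈ S ─ D → v ∈ D → Adj E u v → ⊥
      noEdge {u} {v} u∈ v∈D u~v with ∈desc⁻ v∈D
      ... | v∈S , r-v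
        with closure u v (proj₁ (within (p─q⊆p S D u∈))) (proj₁ (within v∈S)) u~v
      ...   | inj₂ v-u = outside-subtree u∈ (anc-trans r-v v-u)
      ...   | inj₁ u-v with anc-comparable r-v u-v
      ...     | inj₁ r-u = outside-subtree u∈ r-u
      ...     | inj₂ u-r with anc-depth u-r (proj₁ (within r∈S))
      ...       | inj₁ refl = outside-subtree u∈ self
      ...       | inj₂ u<r  = <⇒≱ u<r (shallowest (p─q⊆p S D u∈))


module Chunks {n c : ℕ} (E : List (Fin n × Fin n)) (loopless : ∀ u v → (u , v) ∈ₗ E → u ≢ v)
              {F : Subset n} (forest : TdForest E F c)
              (N : Subset n → Subset n)
              (N-mono : ∀ {Z Z'} → Z ⊆ Z' → N Z ⊆ N Z')
              (N-point : ∀ {Z v} → v ∈ N Z → ∃ λ x → x ∈ Z × v ∈ N ⁅ x ⁆) where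

  open TdForest forest using (depth)
  open IndependenceNumber E
  open Levels forest

  Chunked : ℕ → Subset n → Subset n → ℕ → Set
  Chunked d S Z a = ∃ λ Z' → Z' ⊆ Z × ∣ Z' ∣ ≤ 2 ^ d × α E (S ─ N Z') < a

  ChunkProperty : ℕ → Set
  ChunkProperty d = ∀ {S} → WithinLevels d S → ∀ Z a → α E S ≤ a → α E (S ─ N Z) < a →
                    Chunked d S Z a

  chunk-empty : ∀ d {S} → Empty S → ∀ Z a → α E (S ─ N Z) < a → Chunked d S Z a
  chunk-empty d {S} empty Z a drop =
    ∅ , (λ x∈∅ → ⊥-elim (∉⊥ x∈∅)) , ≤-trans (≤-reflexive (∣⊥∣≡0 n)) z≤n ,
    ≤-<-trans (α-mono (λ x∈ → ⊥-elim (empty (_ , p─q⊆p S (N ∅) x∈)))) drop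

  ─-swap-⊆ : ∀ {D Q Z Z'} → Z ⊆ Z' → D ─ N Z' ─ Q ⊆ D ─ Q ─ N Z
  ─-swap-⊆ {D} {Q} {Z} {Z'} Z⊆Z' =
    ⊆-trans (⊆-reflexive (p─q─r≡p─r─q D (N Z') Q)) (─-mono ⊆-refl (N-mono Z⊆Z'))

  -- If deleting one vertex r of D leaves only d levels, then D has chunks of size
  -- 2^(d+1): one chunk Z₁ handles D - r, and r is handled either by a single
  -- neighbour of r in Z or by a chunk Z₂ of D ─ N[r].
  chunk-root : ∀ d → ChunkProperty d → ∀ {D r} → r ∈ D → WithinLevels d (D - r) →
               ∀ Z a → α E D ≤ a → α E (D ─ N Z) < a → Chunked (suc d) D Z a
  chunk-root d chunk r∈D within Z zero _ ()
  chunk-root d chunk {D} {r} r∈D within Z (suc a) α≤a drop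
    with chunk within Z (suc a) (≤-trans (α-mono (p─q⊆p D ⁅ r ⁆)) α≤a)
                                (≤-<-trans (α-mono (─-mono (p─q⊆p D ⁅ r ⁆) ⊆-refl)) drop)
  ... | Z₁ , Z₁⊆Z , size₁ , drop₁ = handle-r (r ∈? N Z)
    where
    -- Passing to D ─ N[r] loses r, so both α and the threshold drop by one.
    αD─N[r]≤a : α E (D ─ closedNbh r) ≤ a
    αD─N[r]≤a = ≤-pred (≤-trans (α-closedNbh-lower loopless r∈D) α≤a)
    dropD─N[r] : r ∉ N Z → α E (D ─ closedNbh r ─ N Z) < a
    dropD─N[r] r∉NZ = ≤-pred (begin-strict
      suc (α E (D ─ closedNbh r ─ N Z)) ≡⟨ cong (suc ∘ α E) (p─q─r≡p─r─q D (closedNbh r) (N Z)) ⟩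
      suc (α E (D ─ N Z ─ closedNbh r)) ≤⟨ α-closedNbh-lower loopless (x∈p∧x∉q⇒x∈p─q r∈D r∉NZ) ⟩
      α E (D ─ N Z)                     <⟨ drop ⟩
      suc a                             ∎)
      where open ≤-Reasoning
    handle-r : Dec (r ∈ N Z) → Chunked (suc d) D Z (suc a)
    handle-r (yes r∈NZ) with N-point r∈NZ
    ... | x , x∈Z , r∈Nx =
      Z₁ ∪ ⁅ x ⁆ , ∪-⊆ Z₁⊆Z ⁅x⁆⊆Z ,
      ∣p∪q∣≤2^suc d {Z₁} size₁ (≤-trans (≤-reflexive (∣⁅x⁆∣≡1 x)) (m^n>0 2 d)) ,
      ≤-<-trans (α-mono (⊆-trans without-r (─-swap-⊆ (p⊆p∪q ⁅ x ⁆)))) drop₁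
      where
      ⁅x⁆⊆Z : ⁅ x ⁆ ⊆ Z
      ⁅x⁆⊆Z y∈ rewrite x∈⁅y⁆⇒x≡y x y∈ = x∈Z
      -- r is a neighbour of x, so it is gone already
      without-r : D ─ N (Z₁ ∪ ⁅ x ⁆) ⊆ D ─ N (Z₁ ∪ ⁅ x ⁆) - r
      without-r v∈ = x∈p∧x≢y⇒x∈p-y v∈ λ { refl →
        x∈p─q⇒x∉q D _ v∈ (N-mono (q⊆p∪q Z₁ ⁅ x ⁆) r∈Nx) }
    handle-r (no r∉NZ)
      with chunk (within-⊆ (─N[r]⊆-r D r) within) Z a αD─N[r]≤a (dropD─N[r] r∉NZ)
    ... | Z₂ , Z₂⊆Z , size₂ , drop₂ =
      Z₁ ∪ Z₂ , ∪-⊆ Z₁⊆Z Z₂⊆Z , ∣p∪q∣≤2^suc d {Z₁} size₁ size₂ ,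
      ≤-<-trans (α-closedNbh-upper (D ─ N (Z₁ ∪ Z₂)) r)
                (⊔-pres-<m (≤-<-trans (α-mono (─-swap-⊆ (p⊆p∪q Z₂))) drop₁)
                           (s≤s (≤-<-trans (α-mono (─-swap-⊆ (q⊆p∪q Z₁ Z₂))) drop₂)))

  -- d + 1 levels, by induction on |S|: split off the subtree D of a shallowest vertex.
  -- If α drops on D, a chunk of D (chunk-root) works for S; otherwise the drop
  -- happens on S ─ D with the threshold lowered by α(D).
  chunk-step : ∀ d → ChunkProperty d → ChunkProperty (suc d)
  chunk-step d chunk {S} within = go within (<-wellFounded ∣ S ∣)
    where
    go : ∀ {S} → WithinLevels (suc d) S → Acc _<_ ∣ S ∣ →
         ∀ Z a → α E S ≤ a → α E (S ─ N Z) < a → Chunked (suc d) S Z a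
    go {S} within (acc smaller) Z a α≤a drop with nonempty? S
    ... | no empty = chunk-empty (suc d) empty Z a drop
    ... | yes nonempty with minimiser depth S nonempty
    ...   | r , r∈S , shallowest = split-off (α E D ≤? α E (D ─ N Z))
      where
      open Subtree within r∈S shallowest
      whole : α E S ≡ α E (S ─ D) + α E D
      whole = α-split D⊆S separated
      parts : ∀ M → α E (S ─ M) ≡ α E (S ─ D ─ M) + α E (D ─ M)
      parts = α-split-─ D⊆S separated
      αD≤a : α E D ≤ a
      αD≤a = m+n≤o⇒n≤o (α E (S ─ D)) (subst (_≤ a) whole α≤a)
      split-off : Dec (α E D ≤ α E (D ─ N Z)) → Chunked (suc d) S Z a
      split-off (no D-drops) with chunk-root d chunk r∈D within-below-root Z (α E D) ≤-refl (≰⇒> D-drops)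
      ... | Z' , Z'⊆Z , size , dropD = Z' , Z'⊆Z , size , (begin-strict
        α E (S ─ N Z')                      ≡⟨ parts (N Z') ⟩
        α E (S ─ D ─ N Z') + α E (D ─ N Z') <⟨ +-mono-≤-< (α-mono (p─q⊆p (S ─ D) (N Z'))) dropD ⟩
        α E (S ─ D) + α E D                 ≡⟨ whole ⟨
        α E S                               ≤⟨ α≤a ⟩
        a                                   ∎)
        where open ≤-Reasoning
      split-off (yes D-keeps)
        with go (within-⊆ (p─q⊆p S D) within) (smaller (p∩q≢∅⇒∣p─q∣<∣p∣ S D (r , x∈p∩q⁺ (r∈S , r∈D))))
                Z (a ∸ α E D)
                (m+n≤o⇒m≤o∸n (α E (S ─ D)) (subst (_≤ a) whole α≤a))
                (m+n≤o⇒m≤o∸n (suc (α E (S ─ D ─ N Z)))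
                  (≤-trans (s≤s (+-monoʳ-≤ (α E (S ─ D ─ N Z)) D-keeps))
                           (subst (_< a) (parts (N Z)) drop)))
      ... | Z' , Z'⊆Z , size , dropRest = Z' , Z'⊆Z , size , (begin-strict
        α E (S ─ N Z')                      ≡⟨ parts (N Z') ⟩
        α E (S ─ D ─ N Z') + α E (D ─ N Z') ≤⟨ +-monoʳ-≤ (α E (S ─ D ─ N Z')) (α-mono (p─q⊆p D (N Z'))) ⟩
        α E (S ─ D ─ N Z') + α E D          <⟨ m≤o∸n⇒m+n≤o (suc (α E (S ─ D ─ N Z'))) αD≤a dropRest ⟩
        a                                   ∎)
        where open ≤-Reasoning

  chunk : ∀ d → ChunkProperty d
  chunk zero    within Z a _ drop = chunk-empty 0 (within-zero within) Z a drop
  chunk (suc d) = chunk-step d (chunk d)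

  -- A set whose neighbourhood lowers α is nonempty, because N ∅ is empty.
  drop⇒nonempty : ∀ {S Z} → α E (S ─ N Z) < α E S → Nonempty Z
  drop⇒nonempty {S} {Z} drop with nonempty? Z
  ... | yes nonempty = nonempty
  ... | no  empty    = contradiction (α-mono S⊆S─NZ) (<⇒≱ drop)
    where
    S⊆S─NZ : S ⊆ S ─ N Z
    S⊆S─NZ v∈S = x∈p∧x∉q⇒x∈p─q v∈S (λ v∈NZ → let x , x∈Z , _ = N-point v∈NZ in empty (x , x∈Z))

module Neighbourhood {n : ℕ} (E : List (Fin n × Fin n)) (R' : Subset n) where

  ∈Nbh⁻ : ∀ {Z v} → v ∈ Nbh E R' Z → v ∈ R' × ∃ λ x → x ∈ Z × T (adjᵇ E x v)
  ∈Nbh⁻ {Z} {v} v∈ with to (T-∧ {lookup R' v}) (∈-tabulate⁻ v∈)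
  ... | v∈R' , someX with satisfied (any⁻ _ (allFin n) someX)
  ...   | x , tx with to (T-∧ {lookup Z x}) tx
  ...     | x∈Z , x~v = T⇒∈ v∈R' , x , T⇒∈ x∈Z , x~v

  ∈Nbh⁺ : ∀ {Z v x} → v ∈ R' → x ∈ Z → T (adjᵇ E x v) → v ∈ Nbh E R' Z
  ∈Nbh⁺ {Z} {v} {x} v∈R' x∈Z x~v =
    ∈-tabulate⁺ (from T-∧ (∈⇒T v∈R' , any⁺ _ (lose (∈-allFin x) witness)))
    where
    witness : T (lookup Z x ∧ adjᵇ E x v)
    witness = from T-∧ (∈⇒T x∈Z , x~v)

  Nbh-mono : ∀ {Z Z'} → Z ⊆ Z' → Nbh E R' Z ⊆ Nbh E R' Z'
  Nbh-mono Z⊆Z' v∈ with ∈Nbh⁻ v∈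
  ... | v∈R' , x , x∈Z , x~v = ∈Nbh⁺ v∈R' (Z⊆Z' x∈Z) x~v

  Nbh-point : ∀ {Z v} → v ∈ Nbh E R' Z → ∃ λ x → x ∈ Z × v ∈ Nbh E R' ⁅ x ⁆
  Nbh-point v∈ with ∈Nbh⁻ v∈
  ... | v∈R' , x , x∈Z , x~v = x , x∈Z , ∈Nbh⁺ v∈R' (x∈⁅x⁆ x) x~v


lemma4 : (c : ℕ) → 1 ≤ c → (n : ℕ) (X : Subset n) (E : List (Fin n × Fin n))
         (H : List (Subset n)) (k : ℕ) → IsInstance c n X E H k →
         (R' : Subset n) → IsComponent E (∁ X) R' →
         (∃ λ X' → IndepInX X H X' × 0 < conf E R' X') →
         ∃ λ X̄ → Chunk c X H X̄ × 0 < conf E R' X̄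
lemma4 c _ n X E H k inst R' (R'⊆R , _) (X' , (X'⊆X , X'-noHyper) , conf>0) =
  fromChunk (chunk c within X' (α E R') ≤-refl drop)
  where
  open IsInstance inst
  open TdForest td-R using (depth≥1)
  open Neighbourhood E R' using (Nbh-mono; Nbh-point)
  open Chunks E edge-2elem td-R (Nbh E R') Nbh-mono Nbh-point
  open Levels td-R using (WithinLevels)

  drop : α E (R' ─ Nbh E R' X') < α E R'
  drop = m∸n≢0⇒n<m (λ conf≡0 → <⇒≢ conf>0 (sym conf≡0))

  -- Every vertex has depth ≥ 1, so R' lies in the c deepest levels.
  within : WithinLevels c R'
  within {v} v∈R' = R'⊆R v∈R' , +-monoˡ-≤ c (depth≥1 v (R'⊆R v∈R'))

  fromChunk : Chunked c R' X' (α E R') → ∃ λ X̄ → Chunk c X H X̄ × 0 < conf E R' X̄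
  fromChunk (Z , Z⊆X' , size , dropZ) =
    Z , (⊆-trans Z⊆X' X'⊆X , ∣p∣>0 {p = Z} (proj₂ (drop⇒nonempty dropZ)) , size ,
         λ h h∈H h⊆Z → X'-noHyper h h∈H (⊆-trans h⊆Z Z⊆X')) ,
    m<n⇒0<n∸m dropZ
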